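{- Let $s<t$ be relatively prime positive integers, let $n\ge1$ and $i\ge0$ be integers with $i<\min\{s+1,\,n/t\}$, and put $D=\{n-as-bt : a,b\ge0 \text{ integers},\ a+b\le i\}$. Let $\beta$ be a beta-set with $\beta\subset D$ and $\overline{\beta}\cap D=\beta$. Let $k\ge0$ be the integer with $T_k\le|\beta|<T_{k+1}$, where $T_k=k(k+1)/2$. Let $A=\emptyset$ if $|\beta|=T_k$, and otherwise $A=\{n-(i-k)s-bt : b \text{ an integer},\ k+T_k-|\beta|<b\le k\}$. Define $\gamma=\{n-(i-k+1)s-as-bt : a,b\ge0,\ a+b\le k-1\}\cup A$. Then $\beta\prec\gamma$ and $\gamma\subset D$.
   Context: A beta-set is a finite set of positive integers written decreasingly $\{\beta_1>\dots>\beta_m\}$, with associated partition $P(\beta)=(\beta_1-(m-1),\dots,\beta_m)$. For partitions $P=(P_1,\dots,P_m)$, $Q=(Q_1,\dots,Q_r)$ write $P<Q$ if $m\le r$ and $P_j\le Q_j$ for $j\le m$; $\beta\prec\gamma$ means $P(\beta)<P(\gamma)$. The $(s,t)$-closure of a set $\beta$ of positive integers is $\overline{\beta}=\{x-as-bt: x\in\beta,\ a,b\ge0,\ x>as+bt\}$. -}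

module Defs where

open import Data.Nat using (ℕ; zero; suc; _+_; _*_; _∸_; _≤_; _<_; _>_)
open import Data.Nat.DivMod using (_/_)
open import Data.List using (List; []; _∷_; length)
open import Data.List.Relation.Unary.All using (All)
open import Data.List.Relation.Unary.Linked using (Linked)
open import Data.List.Membership.Propositional using (_∈_)
open import Data.Product using (Σ; _×_; ∃)
open import Data.Sum using (_⊎_)
open import Data.Unit using (⊤)
open import Data.Empty using (⊥)
open import Relation.Nullary using (¬_)
open import Relation.Binary.PropositionalEquality using (_≡_)

-- A beta-set: a finite set of positive integers, represented as the
-- list of its elements written strictly decreasingly.
IsBetaSet : List ℕ → Set
IsBetaSet β = Linked _>_ β × All (1 ≤_) β

partition : List ℕ → List ℕ
partition []       = []
partition (x ∷ xs) = (x ∸ length xs) ∷ partition xs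

_<P_ : List ℕ → List ℕ → Set
[]       <P _        = ⊤
(p ∷ ps) <P []       = ⊥
(p ∷ ps) <P (q ∷ qs) = (p ≤ q) × (ps <P qs)

_≺_ : List ℕ → List ℕ → Set
β ≺ γ = partition β <P partition γ

T : ℕ → ℕ
T k = (k * suc k) / 2

InD : (s t n i : ℕ) → ℕ → Set
InD s t n i x = ∃ λ a → ∃ λ b → (a + b ≤ i) × (x + a * s + b * t ≡ n)

InClosure : (s t : ℕ) → List ℕ → ℕ → Set
InClosure s t β x = 1 ≤ x × (∃ λ y → y ∈ β × (∃ λ a → ∃ λ b → x + a * s + b * t ≡ y))

-- x ∈ γ = {n-(i-k+1)s-as-bt : a,b ≥ 0, a+b ≤ k-1} ∪ A, where
-- A = ∅ if |β| = T_k, else {n-(i-k)s-bt : k+T_k-|β| < b ≤ k}.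
-- (m = |β|.)  Natural subtraction is exact here: i+1 ≥ k always, and
-- i ≥ k whenever |β| ≠ T_k.
InGamma : (s t n i k m : ℕ) → ℕ → Set
InGamma s t n i k m x =
  (∃ λ a → ∃ λ b → (a + b + 1 ≤ k) × (x + (suc i ∸ k) * s + a * s + b * t ≡ n))
  ⊎ ((¬ (m ≡ T k)) × (∃ λ b → (k + T k < b + m) × (b ≤ k) × (x + (i ∸ k) * s + b * t ≡ n)))

-- Arrange D as a triangle: row d ≤ i holds the values n − a s − b t with a + b = i − d,
-- indexed by the column b ≤ i − d; since a ≤ i ≤ s < t and gcd(s, t) = 1 these values are
-- pairwise distinct. Closure of β under subtracting s or t puts the cells (d, b) and
-- (d, b + 1) into β whenever (d + 1, b) is in β, so the number of elements of β in row d
-- drops by at least one from each row to the next until it vanishes. Writing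
-- |β| = T_k + r, γ consists of the first k − d cells of row d, plus one more when d < r.
-- A row-count sequence decaying in this way with total at most T_k + r has each of its
-- tail sums bounded by the corresponding tail of this staircase. In every row the cells
-- ≥ v form an initial segment of columns, and these segments grow with d, so the tail
-- bounds give #{x ∈ β | x ≥ v} ≤ #{x ∈ γ | x ≥ v} for every v; for decreasing lists of
-- the same length this is β ≺ γ.

module Submission where

open import Defs
open import Data.Nat using (ℕ; suc; _*_; _≤_; _<_)
open import Data.Nat.Coprimality using (Coprime)
open import Data.List using (List; length)
open import Data.List.Membership.Propositional using (_∈_)
open import Data.Product using (Σ; _×_)
open import Function.Bundles using (_⇔_)

open import Data.Nat
open import Data.Nat.Properties
open import Data.Nat.Tactic.RingSolver using (solve-∀)
open import Data.Nat.DivMod using (_/_; m*n/n≡m)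
open import Data.Nat.Divisibility using (_∣_; divides; ∣⇒≤)
open import Data.Nat.Coprimality using (coprime-divisor)
import Data.Nat.Coprimality as Coprime
open import Data.Product using (_,_; proj₁; proj₂; ∃₂; map₁)
open import Data.Sum using (inj₁; inj₂)
open import Data.Empty using (⊥-elim)
open import Data.Unit using (tt)
open import Data.List using ([]; _∷_; _++_; map; filter; downFrom)
open import Data.List.Properties
  using (length-++; length-map; length-downFrom; length-removeAt′;
         filter-++; filter-accept; filter-none; filter-some)
open import Data.List.Relation.Unary.Any using (here; there; index; _─_)
open import Data.List.Relation.Unary.All as All using (All; []; _∷_)
open import Data.List.Relation.Unary.All.Properties using () renaming (map⁺ to All-map⁺)
open import Data.List.Relation.Unary.AllPairs as AllPairs using ([]; _∷_)
open import Data.List.Relation.Unary.Linked as Linked using (Linked; []; [-]; _∷_)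
open import Data.List.Relation.Unary.Linked.Properties
  using (Linked⇒All; Linked⇒AllPairs; applyDownFrom⁺₂) renaming (filter⁺ to Linked-filter⁺)
open import Data.List.Relation.Unary.Unique.Propositional using (Unique)
open import Data.List.Relation.Unary.Unique.Propositional.Properties
  using (++⁺; downFrom⁺) renaming (filter⁺ to Unique-filter⁺)
open import Data.List.Relation.Binary.Subset.Propositional using (_⊆_)
open import Data.List.Membership.Propositional.Properties
  using (∈-map⁺; ∈-map⁻; ∈-++⁺ˡ; ∈-++⁺ʳ; ∈-++⁻;
         ∈-downFrom⁺; ∈-downFrom⁻; ∈-filter⁺; ∈-filter⁻)
open import Function using (_∘_; id)
open import Function.Bundles using (Equivalence; mk⇔)
open import Data.List.Membership.DecPropositional _≟_ using (_∈?_)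
open import Relation.Nullary using (¬_; yes; no)
open import Relation.Nullary.Decidable using (_×-dec_)
open import Relation.Unary using (Decidable)
open import Relation.Binary.PropositionalEquality
open import Algebra.Properties.CommutativeSemigroup +-commutativeSemigroup using (interchange)

-- Finite sums and triangular numbers

∑ : (ℕ → ℕ) → ℕ → ℕ
∑ f zero    = 0
∑ f (suc n) = f 0 + ∑ (f ∘ suc) n

∑-cong : ∀ {f g} n → (∀ {d} → d < n → f d ≡ g d) → ∑ f n ≡ ∑ g n
∑-cong zero    _  = refl
∑-cong (suc n) eq = cong₂ _+_ (eq z<s) (∑-cong n (eq ∘ s<s))

∑-mono-≤ : ∀ {f g} n → (∀ {d} → d < n → f d ≤ g d) → ∑ f n ≤ ∑ g n
∑-mono-≤ zero    _  = z≤n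
∑-mono-≤ (suc n) le = +-mono-≤ (le z<s) (∑-mono-≤ n (le ∘ s<s))

∑-+ : ∀ f g n → ∑ (λ d → f d + g d) n ≡ ∑ f n + ∑ g n
∑-+ f g zero    = refl
∑-+ f g (suc n) =
  trans (cong (f 0 + g 0 +_) (∑-+ (f ∘ suc) (g ∘ suc) n)) (interchange (f 0) (g 0) _ _)

∑-const : ∀ x n → ∑ (λ _ → x) n ≡ n * x
∑-const x zero    = refl
∑-const x (suc n) = cong (x +_) (∑-const x n)

∑-split : ∀ f D j → ∑ f (D + j) ≡ ∑ f D + ∑ (f ∘ (D +_)) j
∑-split f zero    j = refl
∑-split f (suc D) j = trans (cong (f 0 +_) (∑-split (f ∘ suc) D j)) (sym (+-assoc (f 0) _ _))

∑-zero : ∀ n → ∑ (λ _ → 0) n ≡ 0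
∑-zero n = trans (∑-const 0 n) (*-zeroʳ n)

Tr : ℕ → ℕ
Tr zero    = 0
Tr (suc k) = suc k + Tr k

Tr-+ : ∀ a b → Tr (a + b) ≡ Tr a + a * b + Tr b
Tr-+ zero    b = refl
Tr-+ (suc a) b = trans (cong (suc (a + b) +_) (Tr-+ a b)) (regroup a b (Tr a) (Tr b))
  where
  regroup : ∀ a b x y → suc (a + b) + (x + a * b + y) ≡ suc a + x + suc a * b + y
  regroup = solve-∀

Tr-mono-≤ : ∀ {a b} → a ≤ b → Tr a ≤ Tr b
Tr-mono-≤ {a} {b} a≤b = begin
  Tr a                                  ≤⟨ m≤m+n (Tr a) _ ⟩
  Tr a + a * (b ∸ a)                    ≤⟨ m≤m+n _ _ ⟩
  Tr a + a * (b ∸ a) + Tr (b ∸ a)       ≡⟨ Tr-+ a (b ∸ a) ⟨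
  Tr (a + (b ∸ a))                      ≡⟨ cong Tr (m+[n∸m]≡n a≤b) ⟩
  Tr b                                  ∎
  where open ≤-Reasoning

Tr-≤-split : ∀ k D → Tr k ≤ Tr D + D * (k ∸ D) + Tr (k ∸ D)
Tr-≤-split k D = ≤-trans (Tr-mono-≤ (m≤n+m∸n k D)) (≤-reflexive (Tr-+ D (k ∸ D)))

Tr*2 : ∀ k → Tr k * 2 ≡ k * suc k
Tr*2 zero    = refl
Tr*2 (suc k) = begin
  (suc k + Tr k) * 2         ≡⟨ *-distribʳ-+ 2 (suc k) (Tr k) ⟩
  suc k * 2 + Tr k * 2       ≡⟨ cong (suc k * 2 +_) (Tr*2 k) ⟩
  suc k * 2 + k * suc k      ≡⟨ expand k ⟩
  suc k * suc (suc k)        ∎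
  where
  open ≡-Reasoning
  expand : ∀ k → suc k * 2 + k * suc k ≡ suc k * suc (suc k)
  expand = solve-∀

T≡Tr : ∀ k → T k ≡ Tr k
T≡Tr k = trans (cong (_/ 2) (sym (Tr*2 k))) (m*n/n≡m (Tr k) 2)

Tr-reflects-< : ∀ {a b} → Tr a < Tr b → a < b
Tr-reflects-< Ta<Tb = ≰⇒> λ b≤a → <⇒≱ Ta<Tb (Tr-mono-≤ b≤a)

∑-countdown : ∀ K n → ∑ (K ∸_) n ≡ Tr K ∸ Tr (K ∸ n)
∑-countdown K       zero    = sym (n∸n≡0 (Tr K))
∑-countdown zero    (suc n) = ∑-zero n
∑-countdown (suc K) (suc n) = begin
  suc K + ∑ (K ∸_) n                  ≡⟨ cong (suc K +_) (∑-countdown K n) ⟩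
  suc K + (Tr K ∸ Tr (K ∸ n))         ≡⟨ +-∸-assoc (suc K) (Tr-mono-≤ (m∸n≤m K n)) ⟨
  Tr (suc K) ∸ Tr (K ∸ n)             ∎
  where open ≡-Reasoning

∑-countdown-≤ : ∀ K n → ∑ (K ∸_) n ≤ Tr K
∑-countdown-≤ K n = ≤-trans (≤-reflexive (∑-countdown K n)) (m∸n≤m (Tr K) (Tr (K ∸ n)))

∑-countdown-full : ∀ {K n} → K ≤ n → ∑ (K ∸_) n ≡ Tr K
∑-countdown-full {K} {n} K≤n =
  trans (∑-countdown K n) (cong (λ x → Tr K ∸ Tr x) (m≤n⇒m∸n≡0 K≤n))

m<o∸n⇒m+n<o : ∀ {m n o} → m < o ∸ n → m + n < o
m<o∸n⇒m+n<o {m} {n} lt = m≤o∸n⇒m+n≤o (suc m) (<⇒≤ (m∸n≢0⇒n<m (m<n⇒n≢0 lt))) lt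

-- The staircase

χ< : ℕ → ℕ → ℕ
χ< zero    _       = 0
χ< (suc r) zero    = 1
χ< (suc r) (suc d) = χ< r d

χ<-shift : ∀ r D x → χ< r (D + x) ≡ χ< (r ∸ D) x
χ<-shift r       zero    x = refl
χ<-shift zero    (suc D) x = refl
χ<-shift (suc r) (suc D) x = χ<-shift r D x

χ<-≤1 : ∀ r d → χ< r d ≤ 1
χ<-≤1 zero    _       = z≤n
χ<-≤1 (suc r) zero    = ≤-refl
χ<-≤1 (suc r) (suc d) = χ<-≤1 r d

χ<-anti : ∀ r {d e} → d ≤ e → χ< r e ≤ χ< r d
χ<-anti zero    _         = z≤n
χ<-anti (suc r) {e = e} z≤n = χ<-≤1 (suc r) e
χ<-anti (suc r) (s≤s d≤e) = χ<-anti r d≤e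

∑-χ< : ∀ {r n} → r ≤ n → ∑ (χ< r) n ≡ r
∑-χ< {zero}  {n} _         = ∑-zero n
∑-χ< {suc r}     (s≤s r≤n) = cong suc (∑-χ< r≤n)

χ<-< : ∀ {r d} → d < r → χ< r d ≡ 1
χ<-< {suc r} {zero}  _         = refl
χ<-< {suc r} {suc d} (s≤s d<r) = χ<-< d<r

χ<-≥ : ∀ {r d} → r ≤ d → χ< r d ≡ 0
χ<-≥ {zero}          _         = refl
χ<-≥ {suc r} {suc d} (s≤s r≤d) = χ<-≥ r≤d

-- Row lengths of γ: {n − (i − k + 1)s − as − bt | a + b ≤ k − 1} has k − d cells in row d,
-- and A adds one cell to each row d < r, where |β| = T_k + r.
staircase : ℕ → ℕ → ℕ → ℕ
staircase k r d = (k ∸ d) + χ< r d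

staircase-anti : ∀ k r {d e} → d ≤ e → staircase k r e ≤ staircase k r d
staircase-anti k r d≤e = +-mono-≤ (∸-monoʳ-≤ k d≤e) (χ<-anti r d≤e)

∑-staircase-tail : ∀ {k r} D j → r ≤ k → k ≤ D + j →
                   ∑ (staircase k r ∘ (D +_)) j ≡ Tr (k ∸ D) + (r ∸ D)
∑-staircase-tail {k} {r} D j r≤k k≤D+j = begin
  ∑ (staircase k r ∘ (D +_)) j
    ≡⟨ ∑-cong j (λ {x} _ → cong₂ _+_ (sym (∸-+-assoc k D x)) (χ<-shift r D x)) ⟩
  ∑ (λ x → (k ∸ D ∸ x) + χ< (r ∸ D) x) j
    ≡⟨ ∑-+ _ _ j ⟩
  ∑ ((k ∸ D) ∸_) j + ∑ (χ< (r ∸ D)) j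
    ≡⟨ cong₂ _+_ (∑-countdown-full k∸D≤j) (∑-χ< (≤-trans (∸-monoˡ-≤ D r≤k) k∸D≤j)) ⟩
  Tr (k ∸ D) + (r ∸ D)
    ∎
  where
  open ≡-Reasoning
  k∸D≤j : k ∸ D ≤ j
  k∸D≤j = m≤n+o⇒m∸n≤o k D k≤D+j

data InStaircase (k r d b : ℕ) : Set where
  apex : b + d < k → InStaircase k r d b
  side : b + d ≡ k → d < r → InStaircase k r d b

staircase-< : ∀ {k r d} → d < r → staircase k r d ≡ suc (k ∸ d)
staircase-< {k} {r} {d} d<r = trans (cong (k ∸ d +_) (χ<-< d<r)) (+-comm (k ∸ d) 1)

staircase-≥ : ∀ {k r d} → r ≤ d → staircase k r d ≡ k ∸ d
staircase-≥ {k} {r} {d} r≤d = trans (cong (k ∸ d +_) (χ<-≥ r≤d)) (+-identityʳ (k ∸ d))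

<staircase⇒InStaircase : ∀ {k r d b} → r ≤ k → b < staircase k r d → InStaircase k r d b
<staircase⇒InStaircase {k} {r} {d} {b} r≤k b<st with d <? r
... | no d≮r = apex (m<o∸n⇒m+n<o (subst (b <_) (staircase-≥ (≮⇒≥ d≮r)) b<st))
... | yes d<r with m≤n⇒m<n∨m≡n (s≤s⁻¹ (subst (b <_) (staircase-< d<r) b<st))
...   | inj₁ b<k∸d = apex (m<o∸n⇒m+n<o b<k∸d)
...   | inj₂ b≡k∸d = side (trans (cong (_+ d) b≡k∸d) (m∸n+n≡m (≤-trans (<⇒≤ d<r) r≤k))) d<r

InStaircase⇒<staircase : ∀ {k r d b} → InStaircase k r d b → b < staircase k r d
InStaircase⇒<staircase {k} {r} {d} {b} (apex b+d<k) =
  ≤-trans (m+n≤o⇒m≤o∸n (suc b) b+d<k) (m≤m+n (k ∸ d) (χ< r d))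
InStaircase⇒<staircase {k} {r} {d} {b} (side b+d≡k d<r) =
  subst (b <_) (sym (staircase-< d<r)) (s≤s (≤-reflexive (sym k∸d≡b)))
  where
  k∸d≡b : k ∸ d ≡ b
  k∸d≡b = trans (cong (_∸ d) (sym b+d≡k)) (m+n∸n≡m b d)

-- Decaying sequences are dominated by the staircase

m+n≤o+p⇒m≤o+[p∸n] : ∀ {m n o p} → m + n ≤ o + p → m ≤ o + (p ∸ n)
m+n≤o+p⇒m≤o+[p∸n] {m} {n} {o} {p} le = +-cancelʳ-≤ n m _ (begin
  m + n              ≤⟨ le ⟩
  o + p              ≤⟨ +-monoʳ-≤ o (m≤n+m∸n p n) ⟩
  o + (n + (p ∸ n))  ≡⟨ cong (o +_) (+-comm n (p ∸ n)) ⟩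
  o + (p ∸ n + n)    ≡⟨ +-assoc o (p ∸ n) n ⟨
  o + (p ∸ n) + n    ∎)
  where open ≤-Reasoning

Decaying : ℕ → (ℕ → ℕ) → Set
Decaying N c = ∀ {d} → suc d < N → c (suc d) ≤ pred (c d)

module _ {N} {c : ℕ → ℕ} (decaying : Decaying N c) where

  decay : ∀ D y → D + y < N → c (D + y) ≤ c D ∸ y
  decay D zero    _         = ≤-reflexive (cong c (+-identityʳ D))
  decay D (suc y) D+1+y<N = begin
    c (D + suc y)      ≡⟨ cong c (+-suc D y) ⟩
    c (suc (D + y))    ≤⟨ decaying (subst (_< N) (+-suc D y) D+1+y<N) ⟩
    pred (c (D + y))   ≤⟨ pred-mono-≤ (decay D y (<-trans (+-monoʳ-< D (n<1+n y)) D+1+y<N)) ⟩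
    pred (c D ∸ y)     ≡⟨ pred[m∸n]≡m∸[1+n] (c D) y ⟩
    c D ∸ suc y        ∎
    where open ≤-Reasoning

  ∑-tail-≤-Tr : ∀ D j → D + j ≤ N → ∑ (c ∘ (D +_)) j ≤ Tr (c D)
  ∑-tail-≤-Tr D j D+j≤N = ≤-trans
    (∑-mono-≤ j (λ y<j → decay D _ (<-≤-trans (+-monoʳ-< D y<j) D+j≤N)))
    (∑-countdown-≤ (c D) j)

  ∑-head-≥ : ∀ D → D < N → 1 ≤ c D → D * c D + Tr D ≤ ∑ c D
  ∑-head-≥ D D<N 1≤cD = begin
    D * c D + Tr D                ≡⟨ cong₂ _+_ (∑-const (c D) D) (∑-countdown-full {D} ≤-refl) ⟨
    ∑ (λ _ → c D) D + ∑ (D ∸_) D  ≡⟨ ∑-+ _ _ D ⟨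
    ∑ (λ d → c D + (D ∸ d)) D     ≤⟨ ∑-mono-≤ D grow ⟩
    ∑ c D                         ∎
    where
    open ≤-Reasoning
    grow : ∀ {d} → d < D → c D + (D ∸ d) ≤ c d
    grow {d} d<D = m≤o∸n⇒m+n≤o (c D) (<⇒≤ (m∸n≢0⇒n<m cd∸D∸d≢0)) cD≤
      where
      d+[D∸d]≡D : d + (D ∸ d) ≡ D
      d+[D∸d]≡D = m+[n∸m]≡n (<⇒≤ d<D)
      cD≤ : c D ≤ c d ∸ (D ∸ d)
      cD≤ = subst (λ e → c e ≤ c d ∸ (D ∸ d)) d+[D∸d]≡D
              (decay d (D ∸ d) (subst (_< N) (sym d+[D∸d]≡D) D<N))
      cd∸D∸d≢0 : c d ∸ (D ∸ d) ≢ 0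
      cd∸D∸d≢0 eq = n≮0 (subst (1 ≤_) eq (≤-trans 1≤cD cD≤))

  ∑-tail-≤ : ∀ {k r} → ∑ c N ≤ Tr k + r →
             ∀ D j → D + j ≡ N → ∑ (c ∘ (D +_)) j ≤ Tr (k ∸ D) + (r ∸ D)
  ∑-tail-≤ _ D zero _ = z≤n
  ∑-tail-≤ {k} {r} ∑c≤ D (suc j) D+j≡N with c D ≤? k ∸ D
  ... | yes small = ≤-trans (∑-tail-≤-Tr D (suc j) (≤-reflexive D+j≡N))
                            (≤-trans (Tr-mono-≤ small) (m≤m+n _ _))
  -- If c D > k − D then ∑_{d<D} c d ≥ D (k − D + 1) + T_D, which leaves at most
  -- T_{k−D} + r − D for the tail.
  ... | no big = m+n≤o+p⇒m≤o+[p∸n] (+-cancelˡ-≤ (Tr D + D * (k ∸ D)) _ _ (begin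
    Tr D + D * (k ∸ D) + (tail + D)        ≡⟨ regroup (Tr D) D (k ∸ D) tail ⟩
    D * suc (k ∸ D) + Tr D + tail          ≤⟨ +-monoˡ-≤ tail (+-monoˡ-≤ (Tr D) (*-monoʳ-≤ D k∸D<cD)) ⟩
    D * c D + Tr D + tail                  ≤⟨ +-monoˡ-≤ tail (∑-head-≥ D D<N (≤-trans z<s k∸D<cD)) ⟩
    ∑ c D + tail                           ≡⟨ trans (cong (∑ c) (sym D+j≡N)) (∑-split c D (suc j)) ⟨
    ∑ c N                                  ≤⟨ ∑c≤ ⟩
    Tr k + r                               ≤⟨ +-monoˡ-≤ r (Tr-≤-split k D) ⟩
    Tr D + D * (k ∸ D) + Tr (k ∸ D) + r    ≡⟨ +-assoc (Tr D + D * (k ∸ D)) _ r ⟩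
    Tr D + D * (k ∸ D) + (Tr (k ∸ D) + r)  ∎))
    where
    open ≤-Reasoning
    tail = ∑ (c ∘ (D +_)) (suc j)
    k∸D<cD : k ∸ D < c D
    k∸D<cD = ≰⇒> big
    D<N : D < N
    D<N = subst (D <_) D+j≡N (m<m+n D z<s)
    regroup : ∀ t d e x → t + d * e + (x + d) ≡ d * suc e + t + x
    regroup = solve-∀

∑-⊓-mono : ∀ N {c c′ g : ℕ → ℕ} →
           (∀ {d e} → d ≤ e → c′ e ≤ c′ d) → (∀ {d e} → d ≤ e → g d ≤ g e) →
           (∀ D j → D + j ≡ N → ∑ (c ∘ (D +_)) j ≤ ∑ (c′ ∘ (D +_)) j) →
           ∑ (λ d → c d ⊓ g d) N ≤ ∑ (λ d → c′ d ⊓ g d) N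
-- If c′ 0 ≤ g 0 then c′ ≤ g everywhere and only the total of c matters; otherwise index 0
-- contributes g 0 on the right and we recurse on the remaining indices.
∑-⊓-mono zero    _ _ _ = z≤n
∑-⊓-mono (suc N) {c} {c′} {g} c′-anti g-mono tails with c′ 0 ≤? g 0
... | yes c′0≤g0 = begin
  ∑ (λ d → c d ⊓ g d) (suc N)    ≤⟨ ∑-mono-≤ (suc N) (λ {d} _ → m⊓n≤m (c d) (g d)) ⟩
  ∑ c (suc N)                    ≤⟨ tails 0 (suc N) refl ⟩
  ∑ c′ (suc N)                   ≡⟨ ∑-cong (suc N) (λ {d} _ → m≤n⇒m⊓n≡m (c′≤g {d})) ⟨
  ∑ (λ d → c′ d ⊓ g d) (suc N)   ∎
  where
  open ≤-Reasoning
  c′≤g : ∀ {d} → c′ d ≤ g d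
  c′≤g {d} = ≤-trans (c′-anti z≤n) (≤-trans c′0≤g0 (g-mono z≤n))
... | no c′0≰g0 = +-mono-≤
  (≤-trans (m⊓n≤n (c 0) (g 0)) (≤-reflexive (sym (m≥n⇒m⊓n≡n (<⇒≤ (≰⇒> c′0≰g0))))))
  (∑-⊓-mono N (c′-anti ∘ s≤s) (g-mono ∘ s≤s) (λ D j eq → tails (suc D) j (cong suc eq)))

∑-⊓-staircase : ∀ {N k r} {c g : ℕ → ℕ} →
                Decaying N c → r ≤ k → k ≤ N → ∑ c N ≤ Tr k + r →
                (∀ {d e} → d ≤ e → g d ≤ g e) →
                ∑ (λ d → c d ⊓ g d) N ≤ ∑ (λ d → staircase k r d ⊓ g d) N
∑-⊓-staircase {N} {k} {r} {c} decaying r≤k k≤N ∑c≤ g-mono =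
  ∑-⊓-mono N (staircase-anti k r) g-mono λ D j D+j≡N → begin
    ∑ (c ∘ (D +_)) j                  ≤⟨ ∑-tail-≤ decaying ∑c≤ D j D+j≡N ⟩
    Tr (k ∸ D) + (r ∸ D)              ≡⟨ ∑-staircase-tail D j r≤k (subst (k ≤_) (sym D+j≡N) k≤N) ⟨
    ∑ (staircase k r ∘ (D +_)) j      ∎
  where open ≤-Reasoning

-- Counting in lists

∈-─ : ∀ {A : Set} {x y : A} {ys} (x∈ys : x ∈ ys) → y ∈ ys → y ≢ x → y ∈ (ys ─ x∈ys)
∈-─ (here refl) (here refl)  y≢x = ⊥-elim (y≢x refl)
∈-─ (here _)    (there y∈ys) _   = y∈ys
∈-─ (there _)   (here y≡)    _   = here y≡
∈-─ (there x∈ys) (there y∈ys) y≢x = there (∈-─ x∈ys y∈ys y≢x)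

length-mono-⊆ : ∀ {A : Set} {xs ys : List A} → Unique xs → xs ⊆ ys → length xs ≤ length ys
length-mono-⊆ {xs = []}              _            _     = z≤n
length-mono-⊆ {xs = x ∷ xs} {ys} (x∉xs ∷ !xs) xs⊆ys = begin
  suc (length xs)            ≤⟨ s≤s (length-mono-⊆ !xs xs⊆ys─x) ⟩
  suc (length (ys ─ x∈ys))   ≡⟨ length-removeAt′ ys (index x∈ys) ⟨
  length ys                  ∎
  where
  open ≤-Reasoning
  x∈ys = xs⊆ys (here refl)
  xs⊆ys─x : xs ⊆ (ys ─ x∈ys)
  xs⊆ys─x y∈xs = ∈-─ x∈ys (xs⊆ys (there y∈xs)) (All.lookup x∉xs y∈xs ∘ sym)

Unique-map⁺-on : ∀ {A B : Set} {f : A → B} {xs} →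
                 (∀ {x y} → x ∈ xs → y ∈ xs → f x ≡ f y → x ≡ y) → Unique xs → Unique (map f xs)
Unique-map⁺-on {xs = []}     _   []           = []
Unique-map⁺-on {xs = x ∷ xs} inj (x∉xs ∷ !xs) =
  All-map⁺ (All.tabulate λ y∈xs fx≡fy → All.lookup x∉xs y∈xs (inj (here refl) (there y∈xs) fx≡fy))
  ∷ Unique-map⁺-on (λ x∈ y∈ → inj (there x∈) (there y∈)) !xs

Linked>⇒All< : ∀ {x xs} → Linked _>_ (x ∷ xs) → All (_< x) xs
Linked>⇒All< [-]       = []
Linked>⇒All< (x>y ∷ l) = Linked⇒All (λ a>b b>c → <-trans b>c a>b) x>y l

Linked>⇒Unique : ∀ {xs} → Linked _>_ xs → Unique xs
Linked>⇒Unique = AllPairs.map >⇒≢ ∘ Linked⇒AllPairs (λ a>b b>c → <-trans b>c a>b)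

#≥ : ℕ → List ℕ → ℕ
#≥ v xs = length (filter (v ≤?_) xs)

#≥-accept : ∀ {v x} xs → v ≤ x → #≥ v (x ∷ xs) ≡ suc (#≥ v xs)
#≥-accept xs v≤x = cong length (filter-accept (_ ≤?_) v≤x)

#≥-none : ∀ {v xs} → All (_< v) xs → #≥ v xs ≡ 0
#≥-none xs<v = cong length (filter-none (_ ≤?_) (All.map <⇒≱ xs<v))

≺-of-#≥ : ∀ {xs ys} → Linked _>_ xs → Linked _>_ ys → length xs ≡ length ys →
          (∀ v → #≥ v xs ≤ #≥ v ys) → xs ≺ ys
≺-of-#≥ {[]}                  _  _  _  _   = tt
≺-of-#≥ {x ∷ xs} {y ∷ ys} lx ly eq dom =
  subst (λ L → x ∸ length xs ≤ y ∸ L) (suc-injective eq) (∸-monoˡ-≤ (length xs) x≤y) ,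
  ≺-of-#≥ (Linked.tail lx) (Linked.tail ly) (suc-injective eq) dom′
  where
  x≤y : x ≤ y
  x≤y = ≮⇒≥ λ y<x → n≮0 (begin-strict
    0              <⟨ filter-some (x ≤?_) (here ≤-refl) ⟩
    #≥ x (x ∷ xs)  ≤⟨ dom x ⟩
    #≥ x (y ∷ ys)  ≡⟨ #≥-none (y<x ∷ All.map (λ z<y → <-trans z<y y<x) (Linked>⇒All< ly)) ⟩
    0              ∎)
    where open ≤-Reasoning
  dom′ : ∀ v → #≥ v xs ≤ #≥ v ys
  dom′ v with v ≤? x
  ... | yes v≤x = s≤s⁻¹ (subst₂ _≤_ (#≥-accept xs v≤x) (#≥-accept ys (≤-trans v≤x x≤y)) (dom v))
  ... | no  v≰x = subst (_≤ #≥ v ys) (sym (#≥-none xs<v)) z≤n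
    where
    xs<v : All (_< v) xs
    xs<v = All.map (λ z<x → <-trans z<x (≰⇒> v≰x)) (Linked>⇒All< lx)

count : ∀ {P : ℕ → Set} → Decidable P → ℕ → ℕ
count P? n = length (filter P? (downFrom n))

module _ {P : ℕ → Set} (P? : Decidable P) where

  count-accept : ∀ {n} → P n → count P? (suc n) ≡ suc (count P? n)
  count-accept pn = cong length (filter-accept P? pn)

  count-suc : ∀ n → count P? n ≤ count P? (suc n)
  count-suc n with P? n
  ... | yes _ = n≤1+n _
  ... | no  _ = ≤-refl

  count-monoʳ : ∀ {n n′} → n ≤ n′ → count P? n ≤ count P? n′
  count-monoʳ {n′ = zero}  z≤n = z≤n
  count-monoʳ {n′ = suc n′} n≤ with m≤n⇒m<n∨m≡n n≤
  ... | inj₁ n<1+n′ = ≤-trans (count-monoʳ (s≤s⁻¹ n<1+n′)) (count-suc n′)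
  ... | inj₂ refl   = ≤-refl

  count-all : ∀ n → (∀ {b} → b < n → P b) → count P? n ≡ n
  count-all zero    _   = refl
  count-all (suc n) all with P? n
  ... | yes _ = cong suc (count-all n (all ∘ m<n⇒m<1+n))
  ... | no ¬p = ⊥-elim (¬p (all ≤-refl))

  count-⊓ : (∀ {b b′} → b′ ≤ b → P b → P b′) →
            ∀ {c N} → c ≤ N → c ⊓ count P? N ≤ count P? c
  count-⊓ _      {N = zero}  z≤n = z≤n
  count-⊓ closed {c} {suc N} c≤1+N with m≤n⇒m<n∨m≡n c≤1+N
  ... | inj₂ refl = m⊓n≤n c _
  ... | inj₁ c<1+N with P? N
  ...   | yes pN = ≤-trans (m⊓n≤m c _)
                     (≤-reflexive (sym (count-all c λ b<c → closed (≤-trans (<⇒≤ b<c) (s≤s⁻¹ c<1+N)) pN)))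
  ...   | no  _  = count-⊓ closed (s≤s⁻¹ c<1+N)

module _ {P Q : ℕ → Set} (P? : Decidable P) (Q? : Decidable Q) where

  count-mono : ∀ n → (∀ {b} → b < n → P b → Q b) → count P? n ≤ count Q? n
  count-mono zero    _   = z≤n
  count-mono (suc n) P⇒Q with P? n | Q? n
  ... | yes _ | yes _  = s≤s (count-mono n (P⇒Q ∘ m<n⇒m<1+n))
  ... | yes p | no  ¬q = ⊥-elim (¬q (P⇒Q ≤-refl p))
  ... | no  _ | yes _  = m≤n⇒m≤1+n (count-mono n (P⇒Q ∘ m<n⇒m<1+n))
  ... | no  _ | no  _  = count-mono n (P⇒Q ∘ m<n⇒m<1+n)

  count-upset : ∀ n → (∀ {b} → b < n → P b → Q b × Q (suc b)) → count P? n ≤ pred (count Q? (suc n))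
  count-upset zero    _  = z≤n
  count-upset (suc n) up with P? n
  ... | no  _ = ≤-trans (count-upset n (up ∘ m<n⇒m<1+n)) (pred-mono-≤ (count-suc Q? (suc n)))
  ... | yes p with qn , q1+n ← up ≤-refl p = begin
    suc (count P? n)                 ≤⟨ s≤s (count-mono n λ b<n → proj₁ ∘ up (m<n⇒m<1+n b<n)) ⟩
    suc (count Q? n)                 ≡⟨ count-accept Q? qn ⟨
    count Q? (suc n)                 ≡⟨ cong pred (count-accept Q? q1+n) ⟨
    pred (count Q? (suc (suc n)))    ∎
    where open ≤-Reasoning

cells : (ℕ → ℕ → ℕ) → (ℕ → ℕ) → ℕ → List ℕ
cells V κ zero    = []
cells V κ (suc N) = map (V 0) (downFrom (κ 0)) ++ cells (V ∘ suc) (κ ∘ suc) N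

∈-cells⁺ : ∀ {V κ N d b} → d < N → b < κ d → V d b ∈ cells V κ N
∈-cells⁺ {V} {κ} {suc N} {zero}  _   b<κd = ∈-++⁺ˡ (∈-map⁺ (V 0) (∈-downFrom⁺ b<κd))
∈-cells⁺ {V} {κ} {suc N} {suc d} d<N b<κd =
  ∈-++⁺ʳ (map (V 0) (downFrom (κ 0))) (∈-cells⁺ {V ∘ suc} {κ ∘ suc} (s≤s⁻¹ d<N) b<κd)

∈-cells⁻ : ∀ {V κ} N {x} → x ∈ cells V κ N → ∃₂ λ d b → d < N × b < κ d × x ≡ V d b
∈-cells⁻ {V} {κ} (suc N) x∈ with ∈-++⁻ (map (V 0) (downFrom (κ 0))) x∈
... | inj₁ x∈row  with b , b∈ , x≡ ← ∈-map⁻ (V 0) x∈row = 0 , b , z<s , ∈-downFrom⁻ b∈ , x≡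
... | inj₂ x∈rest with d , b , d<N , b<κd , x≡ ← ∈-cells⁻ N x∈rest = suc d , b , s<s d<N , b<κd , x≡

cells-unique : ∀ {V κ} N →
               (∀ {d d′ b b′} → d < N → d′ < N → b < κ d → b′ < κ d′ →
                  V d b ≡ V d′ b′ → d ≡ d′ × b ≡ b′) →
               Unique (cells V κ N)
cells-unique         zero    _   = []
cells-unique {V} {κ} (suc N) inj = ++⁺ row-unique (cells-unique N shifted) disjoint
  where
  shifted : ∀ {d d′ b b′} → d < N → d′ < N → b < κ (suc d) → b′ < κ (suc d′) →
            V (suc d) b ≡ V (suc d′) b′ → d ≡ d′ × b ≡ b′
  shifted d<N d′<N b<κ b′<κ eq = map₁ suc-injective (inj (s<s d<N) (s<s d′<N) b<κ b′<κ eq)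
  row-unique : Unique (map (V 0) (downFrom (κ 0)))
  row-unique = Unique-map⁺-on
    (λ b∈ b′∈ → proj₂ ∘ inj z<s z<s (∈-downFrom⁻ b∈) (∈-downFrom⁻ b′∈)) (downFrom⁺ (κ 0))
  disjoint : ∀ {x} → ¬ (x ∈ map (V 0) (downFrom (κ 0)) × x ∈ cells (V ∘ suc) (κ ∘ suc) N)
  disjoint (x∈row , x∈rest)
    with b , b∈ , refl ← ∈-map⁻ (V 0) x∈row
       | d , b′ , d<N , b′<κ , eq ← ∈-cells⁻ N x∈rest
    = 0≢1+n (proj₁ (inj z<s (s<s d<N) (∈-downFrom⁻ b∈) b′<κ eq))

length-filter-map : ∀ {P : ℕ → Set} (P? : Decidable P) (f : ℕ → ℕ) xs →
                    length (filter P? (map f xs)) ≡ length (filter (P? ∘ f) xs)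
length-filter-map P? f []       = refl
length-filter-map P? f (x ∷ xs) with P? (f x)
... | yes _ = cong suc (length-filter-map P? f xs)
... | no  _ = length-filter-map P? f xs

count-cells : ∀ {P : ℕ → Set} (P? : Decidable P) V κ N →
              length (filter P? (cells V κ N)) ≡ ∑ (λ d → count (P? ∘ V d) (κ d)) N
count-cells P? V κ zero    = refl
count-cells P? V κ (suc N) = begin
  length (filter P? (row ++ rest))                   ≡⟨ cong length (filter-++ P? row rest) ⟩
  length (filter P? row ++ filter P? rest)           ≡⟨ length-++ (filter P? row) ⟩
  length (filter P? row) + length (filter P? rest)   ≡⟨ cong₂ _+_ (length-filter-map P? (V 0) (downFrom (κ 0)))
                                                                  (count-cells P? (V ∘ suc) (κ ∘ suc) N) ⟩
  ∑ (λ d → count (P? ∘ V d) (κ d)) (suc N)           ∎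
  where
  open ≡-Reasoning
  row  = map (V 0) (downFrom (κ 0))
  rest = cells (V ∘ suc) (κ ∘ suc) N

length-cells : ∀ V κ N → length (cells V κ N) ≡ ∑ κ N
length-cells V κ zero    = refl
length-cells V κ (suc N) = begin
  length (row ++ rest)             ≡⟨ length-++ row ⟩
  length row + length rest         ≡⟨ cong₂ _+_ (trans (length-map (V 0) (downFrom (κ 0))) (length-downFrom (κ 0)))
                                                (length-cells (V ∘ suc) (κ ∘ suc) N) ⟩
  κ 0 + ∑ (κ ∘ suc) N              ∎
  where
  open ≡-Reasoning
  row  = map (V 0) (downFrom (κ 0))
  rest = cells (V ∘ suc) (κ ∘ suc) N

-- The triangle D

∣∧<⇒≡0 : ∀ {m n} → m ∣ n → n < m → n ≡ 0
∣∧<⇒≡0 {n = zero}  _   _   = refl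
∣∧<⇒≡0 {n = suc n} m∣n n<m = ⊥-elim (<⇒≱ n<m (∣⇒≤ m∣n))

coprime-unique-≤ : ∀ {s t a b a′ b′} → Coprime s t → a ≤ a′ → a′ < t →
                   a * s + b * t ≡ a′ * s + b′ * t → a ≡ a′
coprime-unique-≤ {s} {t} {a} {b} {a′} {b′} coprime a≤a′ a′<t eq = begin
  a            ≡⟨ +-identityʳ a ⟨
  a + 0        ≡⟨ cong (a +_) e≡0 ⟨
  a + e        ≡⟨ m+[n∸m]≡n a≤a′ ⟩
  a′           ∎
  where
  open ≡-Reasoning
  e = a′ ∸ a
  regroup : ∀ a e s x → (a + e) * s + x ≡ a * s + (e * s + x)
  regroup = solve-∀
  bt≡es+b′t : b * t ≡ e * s + b′ * t
  bt≡es+b′t = +-cancelˡ-≡ (a * s) _ _ (begin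
    a * s + b * t              ≡⟨ eq ⟩
    a′ * s + b′ * t            ≡⟨ cong (λ x → x * s + b′ * t) (m+[n∸m]≡n a≤a′) ⟨
    (a + e) * s + b′ * t       ≡⟨ regroup a e s (b′ * t) ⟩
    a * s + (e * s + b′ * t)   ∎)
  t∣s*e : t ∣ s * e
  t∣s*e = divides (b ∸ b′) (begin
    s * e                      ≡⟨ *-comm s e ⟩
    e * s                      ≡⟨ m+n∸n≡m (e * s) (b′ * t) ⟨
    e * s + b′ * t ∸ b′ * t    ≡⟨ cong (_∸ b′ * t) bt≡es+b′t ⟨
    b * t ∸ b′ * t             ≡⟨ *-distribʳ-∸ t b b′ ⟨
    (b ∸ b′) * t               ∎)
  e≡0 : e ≡ 0
  e≡0 = ∣∧<⇒≡0 (coprime-divisor (Coprime.sym coprime) t∣s*e) (≤-<-trans (m∸n≤m a′ a) a′<t)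

coprime-unique : ∀ {s t a b a′ b′} → Coprime s t → a < t → a′ < t →
                 a * s + b * t ≡ a′ * s + b′ * t → a ≡ a′ × b ≡ b′
coprime-unique {s} {t} {a} {b} {a′} {b′} coprime a<t a′<t eq = a≡a′ , b≡b′
  where
  a≡a′ : a ≡ a′
  a≡a′ with ≤-total a a′
  ... | inj₁ a≤a′ = coprime-unique-≤ {b = b} {b′ = b′} coprime a≤a′ a′<t eq
  ... | inj₂ a′≤a = sym (coprime-unique-≤ {b = b′} {b′ = b} coprime a′≤a a<t (sym eq))
  instance
    t≢0 : NonZero t
    t≢0 = >-nonZero (≤-<-trans z≤n a<t)
  b≡b′ : b ≡ b′
  b≡b′ = *-cancelʳ-≡ b b′ t (+-cancelˡ-≡ (a * s) _ _
           (trans eq (cong (λ x → x * s + b′ * t) (sym a≡a′))))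

module Grid {s t n i : ℕ} (s<t : s < t) (i≤s : i ≤ s) (coprime : Coprime s t) (it<n : i * t < n) where

  u : ℕ
  u = t ∸ s

  -- n − a s − b t with a + b = i − d, since a s + b t = (a + b) s + b (t − s).
  cell : ℕ → ℕ → ℕ
  cell d b = n ∸ ((i ∸ d) * s + b * u)

  module _ (a b d : ℕ) (a+b+d≡i : a + b + d ≡ i) where

    rep≡offset : a * s + b * t ≡ (i ∸ d) * s + b * u
    rep≡offset = begin
      a * s + b * t         ≡⟨ cong (λ x → a * s + b * x) (m+[n∸m]≡n (<⇒≤ s<t)) ⟨
      a * s + b * (s + u)   ≡⟨ regroup a b s u ⟩
      (a + b) * s + b * u   ≡⟨ cong (λ x → x * s + b * u) (m+n∸n≡m (a + b) d) ⟨
      (a + b + d ∸ d) * s + b * u ≡⟨ cong (λ x → (x ∸ d) * s + b * u) a+b+d≡i ⟩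
      (i ∸ d) * s + b * u   ∎
      where
      open ≡-Reasoning
      regroup : ∀ a b s u → a * s + b * (s + u) ≡ (a + b) * s + b * u
      regroup = solve-∀

    rep<n : a * s + b * t < n
    rep<n = ≤-<-trans (begin
      a * s + b * t    ≤⟨ +-monoˡ-≤ (b * t) (*-monoʳ-≤ a (<⇒≤ s<t)) ⟩
      a * t + b * t    ≡⟨ *-distribʳ-+ t a b ⟨
      (a + b) * t      ≤⟨ *-monoˡ-≤ t (≤-trans (m≤m+n (a + b) d) (≤-reflexive a+b+d≡i)) ⟩
      i * t            ∎) it<n
      where open ≤-Reasoning

    cell-rep : cell d b + a * s + b * t ≡ n
    cell-rep = begin
      cell d b + a * s + b * t          ≡⟨ +-assoc (cell d b) (a * s) (b * t) ⟩
      cell d b + (a * s + b * t)        ≡⟨ cong (cell d b +_) rep≡offset ⟩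
      cell d b + ((i ∸ d) * s + b * u)  ≡⟨ +-comm (cell d b) _ ⟩
      (i ∸ d) * s + b * u + cell d b    ≡⟨ m+[n∸m]≡n (<⇒≤ (subst (_< n) rep≡offset rep<n)) ⟩
      n                                 ∎
      where open ≡-Reasoning

    rep⇒cell : ∀ {x} → x + a * s + b * t ≡ n → x ≡ cell d b
    rep⇒cell {x} eq = begin
      x                          ≡⟨ m+n∸n≡m x o ⟨
      x + o ∸ o                  ≡⟨ cong (λ y → x + y ∸ o) rep≡offset ⟨
      x + (a * s + b * t) ∸ o    ≡⟨ cong (_∸ o) (trans (sym (+-assoc x _ _)) eq) ⟩
      n ∸ o                      ∎
      where
      open ≡-Reasoning
      o = (i ∸ d) * s + b * u

  coords : ∀ b d → b + d ≤ i → i ∸ (b + d) + b + d ≡ i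
  coords b d b+d≤i = trans (+-assoc (i ∸ (b + d)) b d) (m∸n+n≡m b+d≤i)

  cell-positive : ∀ {b d} → b + d ≤ i → 1 ≤ cell d b
  cell-positive {b} {d} b+d≤i = m<n⇒0<n∸m (subst (_< n) (rep≡offset _ b d rep) (rep<n _ b d rep))
    where rep = coords b d b+d≤i

  cell∈D : ∀ {b d} → b + d ≤ i → InD s t n i (cell d b)
  cell∈D {b} {d} b+d≤i =
    i ∸ (b + d) , b , ≤-trans (m≤m+n _ d) (≤-reflexive (coords b d b+d≤i)) , cell-rep _ b d (coords b d b+d≤i)

  D⇒cell : ∀ {x} → InD s t n i x → ∃₂ λ d b → b + d ≤ i × x ≡ cell d b
  D⇒cell (a , b , a+b≤i , eq) =
    i ∸ (a + b) , b , ≤-trans (+-monoˡ-≤ _ (m≤n+m b a)) (≤-reflexive a+b+d≡i) , rep⇒cell a b _ a+b+d≡i eq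
    where
    a+b+d≡i : a + b + (i ∸ (a + b)) ≡ i
    a+b+d≡i = m+[n∸m]≡n a+b≤i

  rep-cancelʳ : ∀ {x y a b} → x + a * s + b * t ≡ y + a * s + b * t → x ≡ y
  rep-cancelʳ {x} {y} {a} {b} eq = +-cancelʳ-≡ (a * s) x y (+-cancelʳ-≡ (b * t) _ _ eq)

  cell-injective : ∀ {b d b′ d′} → b + d ≤ i → b′ + d′ ≤ i →
                   cell d b ≡ cell d′ b′ → d ≡ d′ × b ≡ b′
  cell-injective {b} {d} {b′} {d′} b+d≤i b′+d′≤i eq = d≡d′ , b≡b′
    where
    a = i ∸ (b + d)
    a′ = i ∸ (b′ + d′)
    reps : a * s + b * t ≡ a′ * s + b′ * t
    reps = +-cancelˡ-≡ (cell d b) _ _ (begin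
      cell d b + (a * s + b * t)      ≡⟨ +-assoc (cell d b) _ _ ⟨
      cell d b + a * s + b * t        ≡⟨ cell-rep a b d (coords b d b+d≤i) ⟩
      n                               ≡⟨ cell-rep a′ b′ d′ (coords b′ d′ b′+d′≤i) ⟨
      cell d′ b′ + a′ * s + b′ * t    ≡⟨ cong (λ x → x + a′ * s + b′ * t) eq ⟨
      cell d b + a′ * s + b′ * t      ≡⟨ +-assoc (cell d b) _ _ ⟩
      cell d b + (a′ * s + b′ * t)    ∎)
      where open ≡-Reasoning
    below-t : ∀ m → i ∸ m < t
    below-t m = ≤-<-trans (≤-trans (m∸n≤m i m) i≤s) s<t
    unique = coprime-unique {b = b} {b′ = b′} coprime (below-t (b + d)) (below-t (b′ + d′)) reps
    a≡a′ = proj₁ unique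
    b≡b′ = proj₂ unique
    d≡d′ : d ≡ d′
    d≡d′ = +-cancelˡ-≡ (a + b) d d′ (begin
      a + b + d     ≡⟨ coords b d b+d≤i ⟩
      i             ≡⟨ coords b′ d′ b′+d′≤i ⟨
      a′ + b′ + d′  ≡⟨ cong₂ (λ x y → x + y + d′) a≡a′ b≡b′ ⟨
      a + b + d′    ∎)
      where open ≡-Reasoning

  cell-step-s : ∀ {b d} → b + suc d ≤ i → cell d b + s ≡ cell (suc d) b
  cell-step-s {b} {d} le = rep-cancelʳ {a = a} {b = b} (begin
    cell d b + s + a * s + b * t     ≡⟨ regroup (cell d b) s a (b * t) ⟩
    cell d b + suc a * s + b * t     ≡⟨ cell-rep (suc a) b d (trans (regroup′ a b d) (coords b (suc d) le)) ⟩
    n                                ≡⟨ cell-rep a b (suc d) (coords b (suc d) le) ⟨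
    cell (suc d) b + a * s + b * t   ∎)
    where
    open ≡-Reasoning
    a = i ∸ (b + suc d)
    regroup : ∀ x s a y → x + s + a * s + y ≡ x + suc a * s + y
    regroup = solve-∀
    regroup′ : ∀ a b d → suc a + b + d ≡ a + b + suc d
    regroup′ = solve-∀

  cell-step-t : ∀ {b d} → b + suc d ≤ i → cell d (suc b) + t ≡ cell (suc d) b
  cell-step-t {b} {d} le = rep-cancelʳ {a = a} {b = b} (begin
    cell d (suc b) + t + a * s + b * t   ≡⟨ regroup (cell d (suc b)) t (a * s) b ⟩
    cell d (suc b) + a * s + suc b * t   ≡⟨ cell-rep a (suc b) d (trans (regroup′ a b d) (coords b (suc d) le)) ⟩
    n                                    ≡⟨ cell-rep a b (suc d) (coords b (suc d) le) ⟨
    cell (suc d) b + a * s + b * t       ∎)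
    where
    open ≡-Reasoning
    a = i ∸ (b + suc d)
    regroup : ∀ x t y b → x + t + y + b * t ≡ x + y + suc b * t
    regroup = solve-∀
    regroup′ : ∀ a b d → a + suc b + d ≡ a + b + suc d
    regroup′ = solve-∀

  cell-mono-d : ∀ {d d′ b} → d ≤ d′ → cell d b ≤ cell d′ b
  cell-mono-d d≤d′ = ∸-monoʳ-≤ n (+-monoˡ-≤ _ (*-monoˡ-≤ s (∸-monoʳ-≤ i d≤d′)))

  cell-anti-b : ∀ {d b b′} → b′ ≤ b → cell d b ≤ cell d b′
  cell-anti-b {d} b′≤b = ∸-monoʳ-≤ n (+-monoʳ-≤ ((i ∸ d) * s) (*-monoˡ-≤ u b′≤b))

-- Construction of γ

module Construction
  {s t n i : ℕ} (s<t : s < t) (i≤s : i ≤ s) (coprime : Coprime s t) (it<n : i * t < n)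
  (β : List ℕ) (β-beta : IsBetaSet β) (β⊆D : ∀ x → x ∈ β → InD s t n i x)
  (β-closed : ∀ x → (InClosure s t β x × InD s t n i x) ⇔ x ∈ β)
  (k : ℕ) (Tk≤m : T k ≤ length β) (m<Tk+1 : length β < T (suc k))
  where

  open Grid s<t i≤s coprime it<n

  N m r : ℕ
  N = suc i
  m = length β
  r = m ∸ Tr k

  m≡Tk+r : m ≡ Tr k + r
  m≡Tk+r = sym (m+[n∸m]≡n (subst (_≤ m) (T≡Tr k) Tk≤m))

  r≤k : r ≤ k
  r≤k = s≤s⁻¹ (+-cancelˡ-< (Tr k) r (suc k) (begin-strict
    Tr k + r          ≡⟨ m≡Tk+r ⟨
    m                 <⟨ subst (m <_) (T≡Tr (suc k)) m<Tk+1 ⟩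
    suc k + Tr k      ≡⟨ +-comm (suc k) (Tr k) ⟩
    Tr k + suc k      ∎))
    where open ≤-Reasoning

  β-unique : Unique β
  β-unique = Linked>⇒Unique (proj₁ β-beta)

  Dcells : List ℕ
  Dcells = cells cell (N ∸_) N

  column<⇒in-triangle : ∀ {d b} → b < N ∸ d → b + d ≤ i
  column<⇒in-triangle b<N∸d = s≤s⁻¹ (m<o∸n⇒m+n<o b<N∸d)

  in-triangle⇒column< : ∀ {d b} → b + d ≤ i → d < N × b < N ∸ d
  in-triangle⇒column< {d} {b} b+d≤i =
    s≤s (≤-trans (m≤n+m d b) b+d≤i) , m+n≤o⇒m≤o∸n (suc b) (s≤s b+d≤i)

  Dcells-unique : Unique Dcells
  Dcells-unique = cells-unique {cell} {N ∸_} N λ _ _ b< b′< →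
    cell-injective (column<⇒in-triangle b<) (column<⇒in-triangle b′<)

  β⊆Dcells : β ⊆ Dcells
  β⊆Dcells x∈β with d , b , b+d≤i , refl ← D⇒cell (β⊆D _ x∈β)
    with d<N , b<N∸d ← in-triangle⇒column< {d} {b} b+d≤i = ∈-cells⁺ {cell} {N ∸_} d<N b<N∸d

  m≤TrN : m ≤ Tr N
  m≤TrN = begin
    m              ≤⟨ length-mono-⊆ β-unique β⊆Dcells ⟩
    length Dcells    ≡⟨ length-cells cell (N ∸_) N ⟩
    ∑ (N ∸_) N     ≡⟨ ∑-countdown-full {N} ≤-refl ⟩
    Tr N           ∎
    where open ≤-Reasoning

  k≤N : k ≤ N
  k≤N = s≤s⁻¹ (Tr-reflects-< (begin-strict
    Tr k          ≡⟨ T≡Tr k ⟨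
    T k           ≤⟨ Tk≤m ⟩
    m             ≤⟨ m≤TrN ⟩
    Tr N          <⟨ m<n+m (Tr N) {suc N} z<s ⟩
    Tr (suc N)    ∎))
    where open ≤-Reasoning

  k≤i : 0 < r → k ≤ i
  k≤i 0<r = s≤s⁻¹ (Tr-reflects-< (begin-strict
    Tr k          <⟨ m<m+n (Tr k) 0<r ⟩
    Tr k + r      ≡⟨ m≡Tk+r ⟨
    m             ≤⟨ m≤TrN ⟩
    Tr N          ∎))
    where open ≤-Reasoning

  ∈β-by-closure : ∀ {x y} a c → y ∈ β → x + a * s + c * t ≡ y → 1 ≤ x → InD s t n i x → x ∈ β
  ∈β-by-closure a c y∈β eq 1≤x x∈D =
    Equivalence.to (β-closed _) ((1≤x , _ , y∈β , a , c , eq) , x∈D)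

  β-steps : ∀ {b d} → b + suc d ≤ i → cell (suc d) b ∈ β → cell d b ∈ β × cell d (suc b) ∈ β
  β-steps {b} {d} le y∈β =
    ∈β-by-closure 1 0 y∈β (trans (one-s (cell d b) s t) (cell-step-s le))
      (cell-positive {b} {d} b+d≤i) (cell∈D {b} {d} b+d≤i) ,
    ∈β-by-closure 0 1 y∈β (trans (one-t (cell d (suc b)) s t) (cell-step-t le))
      (cell-positive {suc b} {d} 1+b+d≤i) (cell∈D {suc b} {d} 1+b+d≤i)
    where
    b+d≤i : b + d ≤ i
    b+d≤i = ≤-trans (+-monoʳ-≤ b (n≤1+n d)) le
    1+b+d≤i : suc b + d ≤ i
    1+b+d≤i = subst (_≤ i) (+-suc b d) le
    one-s : ∀ x s t → x + 1 * s + 0 * t ≡ x + s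
    one-s = solve-∀
    one-t : ∀ x s t → x + 0 * s + 1 * t ≡ x + t
    one-t = solve-∀

  βrow : ℕ → ℕ
  βrow d = count (λ b → cell d b ∈? β) (N ∸ d)

  βrow-decaying : Decaying N βrow
  βrow-decaying {d} 1+d<N =
    subst (λ L → βrow (suc d) ≤ pred (count (λ b → cell d b ∈? β) L))
      (sym (+-∸-assoc 1 (<⇒≤ (s≤s⁻¹ 1+d<N))))
      (count-upset (λ b → cell (suc d) b ∈? β) (λ b → cell d b ∈? β) (N ∸ suc d)
        λ b< → β-steps (column<⇒in-triangle b<))

  ∑βrow≤m : ∑ βrow N ≤ m
  ∑βrow≤m = begin
    ∑ βrow N                        ≡⟨ count-cells (_∈? β) cell (N ∸_) N ⟨
    length (filter (_∈? β) Dcells)   ≤⟨ length-mono-⊆ (Unique-filter⁺ (_∈? β) Dcells-unique)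
                                                      (proj₂ ∘ ∈-filter⁻ (_∈? β)) ⟩
    m                              ∎
    where open ≤-Reasoning

  staircase⊆triangle : ∀ {d b} → InStaircase k r d b → b + d ≤ i
  staircase⊆triangle (apex b+d<k)     = s≤s⁻¹ (≤-trans b+d<k k≤N)
  staircase⊆triangle (side b+d≡k d<r) = subst (_≤ i) (sym b+d≡k) (k≤i (≤-<-trans z≤n d<r))

  staircase≤N : ∀ d → staircase k r d ≤ N
  staircase≤N d = ≮⇒≥ λ N<st →
    1+n≰n (≤-trans (m≤m+n N d) (staircase⊆triangle (<staircase⇒InStaircase r≤k N<st)))

  γcells : List ℕ
  γcells = cells cell (staircase k r) N

  ∈γcells⁻ : ∀ {x} → x ∈ γcells → ∃₂ λ d b → InStaircase k r d b × x ≡ cell d b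
  ∈γcells⁻ x∈ with d , b , _ , b< , x≡ ← ∈-cells⁻ N x∈ = d , b , <staircase⇒InStaircase r≤k b< , x≡

  ∈γcells⁺ : ∀ {d b} → InStaircase k r d b → cell d b ∈ γcells
  ∈γcells⁺ {d} {b} in-st =
    ∈-cells⁺ {cell} {staircase k r} (proj₁ (in-triangle⇒column< {d} {b} (staircase⊆triangle in-st)))
      (InStaircase⇒<staircase in-st)

  γcells-unique : Unique γcells
  γcells-unique = cells-unique {cell} {staircase k r} N λ {d} {d′} {b} {b′} _ _ b< b′< →
    cell-injective (staircase⊆triangle (<staircase⇒InStaircase r≤k b<))
                   (staircase⊆triangle (<staircase⇒InStaircase r≤k b′<))

  γ : List ℕ
  γ = filter (_∈? γcells) (downFrom (suc n))

  ∈γ⁻ : ∀ {x} → x ∈ γ → ∃₂ λ d b → InStaircase k r d b × x ≡ cell d b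
  ∈γ⁻ = ∈γcells⁻ ∘ proj₂ ∘ ∈-filter⁻ (_∈? γcells)

  ∈γ⁺ : ∀ {d b} → InStaircase k r d b → cell d b ∈ γ
  ∈γ⁺ {d} {b} in-st =
    ∈-filter⁺ (_∈? γcells) (∈-downFrom⁺ (s≤s (m∸n≤m n ((i ∸ d) * s + b * u)))) (∈γcells⁺ in-st)

  γcells⊆γ : γcells ⊆ γ
  γcells⊆γ x∈ with _ , _ , in-st , refl ← ∈γcells⁻ x∈ = ∈γ⁺ in-st

  γ-decreasing : Linked _>_ γ
  γ-decreasing =
    Linked-filter⁺ (_∈? γcells) (λ a>b b>c → <-trans b>c a>b) (applyDownFrom⁺₂ id (suc n) n<1+n)

  γ-unique : Unique γ
  γ-unique = Linked>⇒Unique γ-decreasing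

  length-γ : length γ ≡ m
  length-γ = begin
    length γ              ≡⟨ ≤-antisym (length-mono-⊆ γ-unique (proj₂ ∘ ∈-filter⁻ (_∈? γcells)))
                                       (length-mono-⊆ γcells-unique γcells⊆γ) ⟩
    length γcells         ≡⟨ length-cells cell (staircase k r) N ⟩
    ∑ (staircase k r) N   ≡⟨ ∑-staircase-tail 0 N r≤k k≤N ⟩
    Tr k + r              ≡⟨ m≡Tk+r ⟨
    m                     ∎
    where open ≡-Reasoning

  module _ (v : ℕ) where

    above : ℕ → ℕ
    above d = count (λ b → v ≤? cell d b) N

    above-mono : ∀ {d e} → d ≤ e → above d ≤ above e
    above-mono {d} {e} d≤e = count-mono (λ b → v ≤? cell d b) (λ b → v ≤? cell e b) N
      λ {b} _ v≤ → ≤-trans v≤ (cell-mono-d {b = b} d≤e)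

    #≥β≤∑ : #≥ v β ≤ ∑ (λ d → βrow d ⊓ above d) N
    #≥β≤∑ = begin
      #≥ v β                                   ≤⟨ length-mono-⊆ (Unique-filter⁺ (v ≤?_) β-unique) sub ⟩
      length (filter Q? Dcells)                  ≡⟨ count-cells Q? cell (N ∸_) N ⟩
      ∑ (λ d → count (Q? ∘ cell d) (N ∸ d)) N  ≤⟨ ∑-mono-≤ N (λ {d} _ → ⊓-glb
          (count-mono (Q? ∘ cell d) (λ b → cell d b ∈? β) (N ∸ d) λ _ → proj₁)
          (≤-trans (count-mono (Q? ∘ cell d) (λ b → v ≤? cell d b) (N ∸ d) λ _ → proj₂)
                   (count-monoʳ (λ b → v ≤? cell d b) (m∸n≤m N d)))) ⟩
      ∑ (λ d → βrow d ⊓ above d) N              ∎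
      where
      open ≤-Reasoning
      Q? : Decidable (λ x → x ∈ β × v ≤ x)
      Q? x = (x ∈? β) ×-dec (v ≤? x)
      sub : filter (v ≤?_) β ⊆ filter Q? Dcells
      sub x∈ with x∈β , v≤x ← ∈-filter⁻ (v ≤?_) x∈ =
        ∈-filter⁺ Q? (β⊆Dcells x∈β) (x∈β , v≤x)

    ∑≤#≥γ : ∑ (λ d → staircase k r d ⊓ above d) N ≤ #≥ v γ
    ∑≤#≥γ = begin
      ∑ (λ d → staircase k r d ⊓ above d) N
        ≤⟨ ∑-mono-≤ N (λ {d} _ → count-⊓ (λ b → v ≤? cell d b)
                                   (λ b′≤b v≤ → ≤-trans v≤ (cell-anti-b {d} b′≤b)) (staircase≤N d)) ⟩
      ∑ (λ d → count (λ b → v ≤? cell d b) (staircase k r d)) N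
        ≡⟨ count-cells (v ≤?_) cell (staircase k r) N ⟨
      #≥ v γcells
        ≤⟨ length-mono-⊆ (Unique-filter⁺ (v ≤?_) γcells-unique) sub ⟩
      #≥ v γ
        ∎
      where
      open ≤-Reasoning
      sub : filter (v ≤?_) γcells ⊆ filter (v ≤?_) γ
      sub x∈ with x∈γc , v≤x ← ∈-filter⁻ (v ≤?_) x∈ =
        ∈-filter⁺ (v ≤?_) (γcells⊆γ x∈γc) v≤x

    #≥β≤#≥γ : #≥ v β ≤ #≥ v γ
    #≥β≤#≥γ = begin
      #≥ v β                                  ≤⟨ #≥β≤∑ ⟩
      ∑ (λ d → βrow d ⊓ above d) N            ≤⟨ ∑-⊓-staircase {c = βrow} βrow-decaying r≤k k≤N
                                                   (≤-trans ∑βrow≤m (≤-reflexive m≡Tk+r)) above-mono ⟩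
      ∑ (λ d → staircase k r d ⊓ above d) N   ≤⟨ ∑≤#≥γ ⟩
      #≥ v γ                                  ∎
      where open ≤-Reasoning

  β≺γ : β ≺ γ
  β≺γ = ≺-of-#≥ (proj₁ β-beta) γ-decreasing (sym length-γ) #≥β≤#≥γ

  m≢Tk⇒0<r : ¬ m ≡ T k → 0 < r
  m≢Tk⇒0<r m≢Tk = n≢0⇒n>0 λ r≡0 → m≢Tk (begin
    m          ≡⟨ m≡Tk+r ⟩
    Tr k + r   ≡⟨ cong (Tr k +_) r≡0 ⟩
    Tr k + 0   ≡⟨ +-identityʳ (Tr k) ⟩
    Tr k       ≡⟨ T≡Tr k ⟨
    T k        ∎)
    where open ≡-Reasoning

  0<r⇒m≢Tk : 0 < r → ¬ m ≡ T k
  0<r⇒m≢Tk 0<r m≡Tk = n>0⇒n≢0 0<r (+-cancelˡ-≡ (Tr k) r 0 (begin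
    Tr k + r   ≡⟨ m≡Tk+r ⟨
    m          ≡⟨ m≡Tk ⟩
    T k        ≡⟨ T≡Tr k ⟩
    Tr k       ≡⟨ +-identityʳ (Tr k) ⟨
    Tr k + 0   ∎))
    where open ≡-Reasoning

  module _ {b d} (b+d≡k : b + d ≡ k) where

    private
      k+Tk≡ : k + T k ≡ b + d + Tr k
      k+Tk≡ = cong₂ _+_ (sym b+d≡k) (T≡Tr k)
      b+m≡ : b + m ≡ b + r + Tr k
      b+m≡ = trans (cong (b +_) m≡Tk+r) (regroup b (Tr k) r)
        where
        regroup : ∀ b x r → b + (x + r) ≡ b + r + x
        regroup = solve-∀

    k+Tk<b+m⇒d<r : k + T k < b + m → d < r
    k+Tk<b+m⇒d<r lt = +-cancelˡ-< b d r (+-cancelʳ-< (Tr k) (b + d) (b + r) (subst₂ _<_ k+Tk≡ b+m≡ lt))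

    d<r⇒k+Tk<b+m : d < r → k + T k < b + m
    d<r⇒k+Tk<b+m d<r = subst₂ _<_ (sym k+Tk≡) (sym b+m≡) (+-monoˡ-< (Tr k) (+-monoʳ-< b d<r))

    side-coords : k ≤ i → i ∸ k + b + d ≡ i
    side-coords k≤i′ = trans (+-assoc (i ∸ k) b d) (trans (cong (i ∸ k +_) b+d≡k) (m∸n+n≡m k≤i′))

  apex-coords : ∀ {a b d} → suc (a + b + d) ≡ k → suc i ∸ k + a + b + d ≡ i
  apex-coords {a} {b} {d} eq = suc-injective (begin
    suc (suc i ∸ k + a + b + d)      ≡⟨ regroup (suc i ∸ k) a b d ⟩
    suc i ∸ k + suc (a + b + d)      ≡⟨ cong (suc i ∸ k +_) eq ⟩
    suc i ∸ k + k                    ≡⟨ m∸n+n≡m k≤N ⟩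
    suc i                            ∎)
    where
    open ≡-Reasoning
    regroup : ∀ e a b d → suc (e + a + b + d) ≡ e + suc (a + b + d)
    regroup = solve-∀

  apex-rep : ∀ x e a b → x + e * s + a * s + b * t ≡ x + (e + a) * s + b * t
  apex-rep x e a b = regroup x e a b s t
    where
    regroup : ∀ x e a b s t → x + e * s + a * s + b * t ≡ x + (e + a) * s + b * t
    regroup = solve-∀

  InGamma⇒cell : ∀ {x} → InGamma s t n i k m x → ∃₂ λ d b → InStaircase k r d b × x ≡ cell d b
  InGamma⇒cell {x} (inj₁ (a , b , a+b+1≤k , eq)) =
    d , b , apex (≤-trans (s≤s (+-monoˡ-≤ d (m≤n+m b a))) (≤-reflexive 1+a+b+d≡k)) ,
    rep⇒cell (suc i ∸ k + a) b d (apex-coords 1+a+b+d≡k) (trans (sym (apex-rep x (suc i ∸ k) a b)) eq)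
    where
    d = k ∸ suc (a + b)
    1+a+b+d≡k : suc (a + b + d) ≡ k
    1+a+b+d≡k = trans (+-comm (suc (a + b)) d) (m∸n+n≡m (subst (_≤ k) (+-comm (a + b) 1) a+b+1≤k))
  InGamma⇒cell (inj₂ (m≢Tk , b , k+Tk<b+m , b≤k , eq)) =
    k ∸ b , b , side b+d≡k (k+Tk<b+m⇒d<r b+d≡k k+Tk<b+m) ,
    rep⇒cell (i ∸ k) b (k ∸ b) (side-coords b+d≡k (k≤i (m≢Tk⇒0<r m≢Tk))) eq
    where
    b+d≡k : b + (k ∸ b) ≡ k
    b+d≡k = m+[n∸m]≡n b≤k

  cell⇒InGamma : ∀ {d b} → InStaircase k r d b → InGamma s t n i k m (cell d b)
  cell⇒InGamma {d} {b} (apex b+d<k) =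
    inj₁ (a , b , a+b+1≤k ,
          trans (apex-rep (cell d b) (suc i ∸ k) a b) (cell-rep (suc i ∸ k + a) b d (apex-coords 1+a+b+d≡k)))
    where
    a = k ∸ suc (b + d)
    a+1+b+d≡k : a + suc (b + d) ≡ k
    a+1+b+d≡k = m∸n+n≡m b+d<k
    regroup : ∀ a b d → suc (a + b + d) ≡ a + suc (b + d)
    regroup = solve-∀
    1+a+b+d≡k : suc (a + b + d) ≡ k
    1+a+b+d≡k = trans (regroup a b d) a+1+b+d≡k
    a+b+1≤k : a + b + 1 ≤ k
    a+b+1≤k = subst (_≤ k) (+-comm 1 (a + b)) (≤-trans (s≤s (m≤m+n (a + b) d)) (≤-reflexive 1+a+b+d≡k))
  cell⇒InGamma {d} {b} (side b+d≡k d<r) =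
    inj₂ (0<r⇒m≢Tk 0<r , b , d<r⇒k+Tk<b+m b+d≡k d<r , subst (b ≤_) b+d≡k (m≤m+n b d) ,
          cell-rep (i ∸ k) b d (side-coords b+d≡k (k≤i 0<r)))
    where
    0<r : 0 < r
    0<r = ≤-<-trans z≤n d<r

  γ-beta : IsBetaSet γ
  γ-beta = γ-decreasing , All.tabulate positive
    where
    positive : ∀ {x} → x ∈ γ → 1 ≤ x
    positive x∈γ with d , b , in-st , refl ← ∈γ⁻ x∈γ = cell-positive {b} {d} (staircase⊆triangle in-st)

  γ⊆D : ∀ x → x ∈ γ → InD s t n i x
  γ⊆D _ x∈γ with d , b , in-st , refl ← ∈γ⁻ x∈γ = cell∈D {b} {d} (staircase⊆triangle in-st)

  ∈γ⇔InGamma : ∀ x → x ∈ γ ⇔ InGamma s t n i k m x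
  ∈γ⇔InGamma x = mk⇔ to from
    where
    to : x ∈ γ → InGamma s t n i k m x
    to x∈γ with _ , _ , in-st , refl ← ∈γ⁻ x∈γ = cell⇒InGamma in-st
    from : InGamma s t n i k m x → x ∈ γ
    from x∈Γ with _ , _ , in-st , refl ← InGamma⇒cell x∈Γ = ∈γ⁺ in-st

lemma4p4 : (s t n i : ℕ) → 1 ≤ s → s < t → Coprime s t → 1 ≤ n → i < suc s → i * t < n →
    (β : List ℕ) → IsBetaSet β →
    (∀ x → x ∈ β → InD s t n i x) →
    (∀ x → (InClosure s t β x × InD s t n i x) ⇔ x ∈ β) →
    (k : ℕ) → T k ≤ length β → length β < T (suc k) →
    Σ (List ℕ) (λ γ → IsBetaSet γ
    × (∀ x → x ∈ γ ⇔ InGamma s t n i k (length β) x)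
    × (β ≺ γ)
    × (∀ x → x ∈ γ → InD s t n i x))
lemma4p4 s t n i _ s<t coprime _ i<1+s it<n β β-beta β⊆D β-closed k Tk≤m m<Tk+1 =
  γ , γ-beta , ∈γ⇔InGamma , β≺γ , γ⊆D
  where open Construction s<t (s≤s⁻¹ i<1+s) coprime it<n β β-beta β⊆D β-closed k Tk≤m m<Tk+1
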